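{- Let $T$ be a tree of order $n$ with $b(T)\geq 1$. Then \[ \alpha_{\operatorname{bn}}(T)\geq n-b(T)-|W_{\operatorname{int}}(T)|+\alpha(\operatorname{Int}(T)). \]
   Context: A broadcast on a nontrivial connected graph $G=(V,E)$ is a function $f:V\to\{0,1,\dots,\operatorname{diam}(G)\}$ with $f(v)\leq e(v)$ (the eccentricity of $v$) for all $v\in V$; its weight is $\sigma(f)=\sum_{v\in V}f(v)$. A vertex $u$ hears $f$ from $v$ if $f(v)>0$ and $d(u,v)\leq f(v)$. A broadcast $f$ is boundary independent (bn-independent) if, for any vertex $w$ that hears $f$ from vertices $v_1,\dots,v_k$ with $k\geq 2$, we have $d(w,v_i)=f(v_i)$ for each $i$. $\alpha_{\operatorname{bn}}(G)$ denotes the maximum weight of a bn-independent broadcast on $G$, and $\alpha(G)$ denotes the (ordinary) independence number. For a tree $T$: a branch vertex is a vertex of degree at least $3$; $B(T)$ is the set of branch vertices and $b(T)=|B(T)|$. An endpath is a path ending in a leaf all of whose internal vertices (if any) have degree $2$. For a branch vertex $v$, its leaf set $L(v)$ is the set of leaves $l$ such that the $v$–$l$ path is an endpath (i.e., all its internal vertices have degree 2). $B_i(T)=\{v\in B(T):|L(v)|=i\}$. Let $W(T)$ be the set of degree-$2$ vertices; $W_{\operatorname{ext}}(T)$ is the set of those lying on an endpath, and $W_{\operatorname{int}}(T)=W(T)-W_{\operatorname{ext}}(T)$. The interior subgraph $\operatorname{Int}(T)$ is the subgraph of $T$ induced by $B_0(T)\cup B_1(T)\cup W_{\operatorname{int}}(T)$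 (not necessarily connected). -}

module Defs where

open import Data.Nat using (ℕ; zero; suc; _+_; _≤_; _<_; _⊔_)
open import Data.Bool using (Bool; true; false; _∨_; _∧_; if_then_else_; T)
open import Data.Fin using (Fin; _≟_)
open import Data.List using (List; []; _∷_; map; foldr; allFin; length)
open import Data.Nat.ListAction using (sum)
open import Data.Bool.ListAction using (any)
open import Data.List.Membership.Propositional using (_∈_)
open import Data.List.Relation.Unary.Unique.Propositional using (Unique)
open import Data.List.Relation.Unary.Linked using (Linked)
open import Data.Product using (Σ; _×_; ∃; ∃-syntax)
open import Data.Sum using (_⊎_)
open import Data.Unit using (⊤)
open import Data.Empty using (⊥)
open import Relation.Nullary using (¬_; does)
open import Relation.Binary.PropositionalEquality using (_≡_; _≢_)

record Graph (n : ℕ) : Set where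
  field
    adj     : Fin n → Fin n → Bool
    symm    : ∀ u v → adj u v ≡ adj v u
    irrefl  : ∀ v → adj v v ≡ false

open Graph public

module _ {n : ℕ} (G : Graph n) where

  Adj : Fin n → Fin n → Set
  Adj u v = T (adj G u v)

  deg : Fin n → ℕ
  deg v = sum (map (λ u → if adj G v u then 1 else 0) (allFin n))

  lastOr : Fin n → List (Fin n) → Fin n
  lastOr x []       = x
  lastOr x (y ∷ ys) = lastOr y ys

  IsPath : Fin n → Fin n → List (Fin n) → Set
  IsPath u v []       = ⊥
  IsPath u v (x ∷ xs) =
    (x ≡ u) × (lastOr x xs ≡ v) × Unique (x ∷ xs) × Linked Adj (x ∷ xs)

  -- P holds at every internal vertex (all but the first and last)
  private
    Middle : (Fin n → Set) → List (Fin n) → Set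
    Middle P []           = ⊤
    Middle P (y ∷ [])     = ⊤
    Middle P (y ∷ z ∷ zs) = P y × Middle P (z ∷ zs)

  Internal : (Fin n → Set) → List (Fin n) → Set
  Internal P []       = ⊤
  Internal P (x ∷ xs) = Middle P xs

  Connected : Set
  Connected = ∀ u v → ∃[ p ] IsPath u v p

  IsCycle : List (Fin n) → Set
  IsCycle []       = ⊥
  IsCycle (x ∷ xs) =
    (3 ≤ length (x ∷ xs)) × Unique (x ∷ xs) × Linked Adj (x ∷ xs) × Adj (lastOr x xs) x

  Acyclic : Set
  Acyclic = ∀ c → ¬ IsCycle c

  IsTree : Set
  IsTree = Connected × Acyclic

  reach : ℕ → Fin n → Fin n → Bool
  reach zero    u v = does (u ≟ v)
  reach (suc k) u v = reach k u v ∨ any (λ w → adj G u w ∧ reach k w v) (allFin n)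

  -- least k ≤ m with p k (or m if there is none)
  private
    minK : (ℕ → Bool) → ℕ → ℕ
    minK p zero    = zero
    minK p (suc m) = if p zero then zero else suc (minK (λ k → p (suc k)) m)

  dist : Fin n → Fin n → ℕ
  dist u v = minK (λ k → reach k u v) n

  ecc : Fin n → ℕ
  ecc v = foldr _⊔_ 0 (map (dist v) (allFin n))

  -- f : V → ℕ with f v ≤ e(v) (which also gives f v ≤ diam G)
  IsBroadcast : (Fin n → ℕ) → Set
  IsBroadcast f = ∀ v → f v ≤ ecc v

  weight : (Fin n → ℕ) → ℕ
  weight f = sum (map f (allFin n))

  Hears : (Fin n → ℕ) → Fin n → Fin n → Set
  Hears f u v = (0 < f v) × (dist u v ≤ f v)

  BnIndependent : (Fin n → ℕ) → Set
  BnIndependent f = ∀ w v₁ v₂ → v₁ ≢ v₂ → Hears f w v₁ → Hears f w v₂ →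
    (dist w v₁ ≡ f v₁) × (dist w v₂ ≡ f v₂)

  IsLeaf : Fin n → Set
  IsLeaf v = deg v ≡ 1

  IsBranch : Fin n → Set
  IsBranch v = 3 ≤ deg v

  Deg2 : Fin n → Set
  Deg2 v = deg v ≡ 2

  InLeafSet : Fin n → Fin n → Set
  InLeafSet v l = IsLeaf l × ∃[ p ] (IsPath v l p × Internal Deg2 p)

  IsEndpath : List (Fin n) → Set
  IsEndpath p = ∃[ u ] ∃[ l ] (IsPath u l p × IsLeaf l × Internal Deg2 p)

  InWext : Fin n → Set
  InWext w = Deg2 w × ∃[ p ] (IsEndpath p × w ∈ p)

  InWint : Fin n → Set
  InWint w = Deg2 w × ¬ InWext w

  InB₀ : Fin n → Set
  InB₀ v = IsBranch v × (∀ l → ¬ InLeafSet v l)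

  InB₁ : Fin n → Set
  InB₁ v = IsBranch v × ∃[ l ] (InLeafSet v l × (∀ l′ → InLeafSet v l′ → l′ ≡ l))

  -- vertex set of the interior subgraph Int(T) = T[B₀ ∪ B₁ ∪ W_int]
  InInt : Fin n → Set
  InInt v = InB₀ v ⊎ InB₁ v ⊎ InWint v

-- For a leaf l let b(l) be its nearest branch vertex and m(l) = d(l, b(l)); the l–b(l) path is
-- the endpath of l. Broadcast f(l) = m(l) from every leaf, plus 1 when b(l) ∈ S, and f(s) = 1 from
-- every s ∈ S that is b(l) for no leaf l. A walk leaving an endpath must pass through its branch
-- vertex, S is independent, and b ∈ S forces |L(b)| ≤ 1, so two leaves never both get the extra 1
-- at a shared b; hence f(v) + f(w) ≤ d(v, w) for distinct broadcasting v, w, which is exactly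
-- bn-independence. For the weight, charge every vertex of S and every vertex outside B ∪ W_int
-- (a leaf or a vertex of W_ext) to a leaf whose endpath contains it, or else to itself: a leaf l
-- receives at most m(l) charges from its endpath and one more from b(l) ∈ S, any other vertex at
-- most f of itself. As S ⊆ B ∪ W_int, this gives n + |S| ≤ σ(f) + |B| + |W_int|.

module Submission where

open import Defs
open import Data.Bool using (Bool; true; false; T; T?; if_then_else_)
open import Data.Bool.Properties using (T-∨; T-∧; T-≡)
open import Data.Empty using (⊥)
open import Data.Fin using (Fin; zero; suc; toℕ; fromℕ<; _≟_)
import Data.Fin.Properties as Fin
open import Data.Fin.Subset using (Subset; ∣_∣; Nonempty; _∈_; _∉_)
open import Data.Fin.Subset.Properties using (_∈?_; nonempty?; Empty-unique; ∣⊥∣≡0)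
open import Data.List using (List; []; _∷_; map; allFin; tabulate; length; filter; foldr)
open import Data.List.Extrema.Nat using (argmin; argmin-all; f[argmin]≤f[xs])
open import Data.List.Membership.Propositional using (lose) renaming (_∈_ to _∈ˡ_)
open import Data.List.Membership.Propositional.Properties using (∈-allFin; ∈-filter⁺)
open import Data.List.Properties using (map-tabulate)
open import Data.List.Relation.Unary.All using ([]; _∷_)
import Data.List.Relation.Unary.All as All
open import Data.List.Relation.Unary.All.Properties using (All¬⇒¬Any; all-filter)
open import Data.List.Relation.Unary.AllPairs using ([]; _∷_)
open import Data.List.Relation.Unary.Any using (here; there; satisfied)
open import Data.List.Relation.Unary.Any.Properties using (any⁺; any⁻)
open import Data.List.Relation.Unary.Linked using (Linked; [-]; _∷_)
open import Data.List.Relation.Unary.Unique.Propositional using (Unique)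
import Data.Nat as ℕ
open import Data.Nat using (ℕ; zero; suc; _+_; _*_; _∸_; _⊔_; _≤_; _<_; z≤n; s≤s; _≤′_; ≤′-reflexive; ≤′-step)
import Data.Nat.ListAction as List
open import Data.Nat.Properties hiding (_≟_)
open import Algebra.Properties.CommutativeMonoid.Sum +-0-commutativeMonoid
  using (sum-syntax; sum-cong-≗; ∑-distrib-+; ∑-comm)
open import Algebra.Properties.CommutativeSemigroup +-commutativeSemigroup using (x∙yz≈y∙xz)
open import Data.Product using (_×_; _,_; proj₁; proj₂; ∃; ∃-syntax)
open import Data.Sum using (_⊎_; inj₁; inj₂; [_,_]′)
open import Data.Vec using ([]; _∷_)
open import Function using (_∘_)
open import Function.Bundles using (_⇔_; Equivalence; mk⇔)
open import Relation.Binary.PropositionalEquality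
open import Relation.Nullary using (¬_; Dec; yes; no; does; _×-dec_; _⊎-dec_; ¬?; contradiction)
open import Relation.Nullary.Decidable using (decidable-stable; dec-true; dec-false; does-⇔)

open Equivalence using (to; from)

-- Arithmetic, indicators and finite sums

+-≤-via-∸ : ∀ {m k t} → m ≤ k → t ≤ k ∸ m → m + t ≤ k
+-≤-via-∸ {m} m≤k t≤ = ≤-trans (+-monoʳ-≤ m t≤) (≤-reflexive (m+[n∸m]≡n m≤k))

≤-+-tight : ∀ {a b c d} → a ≤ c → b ≤ d → c + d ≤ a + b → a ≡ c × b ≡ d
≤-+-tight {a} {b} {c} {d} a≤c b≤d c+d≤a+b =
  ≤-antisym a≤c (+-cancelʳ-≤ d c a (≤-trans c+d≤a+b (+-monoʳ-≤ a b≤d))) ,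
  ≤-antisym b≤d (+-cancelˡ-≤ c d b (≤-trans c+d≤a+b (+-monoˡ-≤ b a≤c)))

𝟙 : ∀ {P : Set} → Dec P → ℕ
𝟙 d = if does d then 1 else 0

module _ {P : Set} where

  𝟙-yes : (d : Dec P) → P → 𝟙 d ≡ 1
  𝟙-yes (yes _) _ = refl
  𝟙-yes (no ¬p) p = contradiction p ¬p

  𝟙-no : (d : Dec P) → ¬ P → 𝟙 d ≡ 0
  𝟙-no (yes p) ¬p = contradiction p ¬p
  𝟙-no (no _)  _  = refl

  𝟙≤1 : (d : Dec P) → 𝟙 d ≤ 1
  𝟙≤1 (yes _) = s≤s z≤n
  𝟙≤1 (no _)  = z≤n

  𝟙-cong : ∀ {Q : Set} → (P → Q) → (Q → P) → (d : Dec P) (e : Dec Q) → 𝟙 d ≡ 𝟙 e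
  𝟙-cong p⇒q q⇒p d e = cong (if_then 1 else 0) (does-⇔ (mk⇔ p⇒q q⇒p) d e)

  𝟙≢0⇒ : (d : Dec P) → 𝟙 d ≢ 0 → P
  𝟙≢0⇒ (yes p) _  = p
  𝟙≢0⇒ (no _)  ne = contradiction refl ne

𝟙*-≤ : ∀ {P : Set} (d : Dec P) c {y} → (P → c ≤ y) → 𝟙 d * c ≤ y
𝟙*-≤ (yes p) c c≤y = ≤-trans (≤-reflexive (*-identityˡ c)) (c≤y p)
𝟙*-≤ (no _)  c _   = z≤n

∑-mono-≤ : ∀ {n} {f g : Fin n → ℕ} → (∀ i → f i ≤ g i) → ∑[ i < n ] f i ≤ ∑[ i < n ] g i
∑-mono-≤ {zero}  f≤g = z≤n
∑-mono-≤ {suc n} f≤g = +-mono-≤ (f≤g zero) (∑-mono-≤ (f≤g ∘ suc))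

∑-const-1 : ∀ n → ∑[ i < n ] 1 ≡ n
∑-const-1 zero    = refl
∑-const-1 (suc n) = cong suc (∑-const-1 n)

∑-vanishing : ∀ {n} {f : Fin n → ℕ} → (∀ i → f i ≡ 0) → ∑[ i < n ] f i ≡ 0
∑-vanishing {zero}  f≡0 = refl
∑-vanishing {suc n} f≡0 = cong₂ _+_ (f≡0 zero) (∑-vanishing (f≡0 ∘ suc))

term≤∑ : ∀ {n} (f : Fin n → ℕ) i → f i ≤ ∑[ j < n ] f j
term≤∑ f zero    = m≤m+n (f zero) _
term≤∑ f (suc i) = ≤-trans (term≤∑ (f ∘ suc) i) (m≤n+m _ (f zero))

∑-supported-at : ∀ {n} {f : Fin n → ℕ} a → (∀ i → i ≢ a → f i ≡ 0) → ∑[ i < n ] f i ≡ f a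
∑-supported-at {suc n} {f} zero    off = begin
  f zero + ∑[ i < n ] f (suc i) ≡⟨ cong (f zero +_) (∑-vanishing (λ i → off (suc i) λ ())) ⟩
  f zero + 0                    ≡⟨ +-identityʳ (f zero) ⟩
  f zero                        ∎
  where open ≡-Reasoning
∑-supported-at {suc n} {f} (suc a) off =
  cong₂ _+_ (off zero λ ()) (∑-supported-at a λ i i≢a → off (suc i) (i≢a ∘ Fin.suc-injective))

∑-≤1 : ∀ {n} {f : Fin n → ℕ} → (∀ i → f i ≤ 1) → (∀ i j → f i ≢ 0 → f j ≢ 0 → i ≡ j) →
       ∑[ i < n ] f i ≤ 1
∑-≤1 {f = f} f≤1 unique with Fin.any? (λ i → ¬? (f i ℕ.≟ 0))
... | yes (a , fa≢0) = subst (_≤ 1) (sym (∑-supported-at a off)) (f≤1 a)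
  where
  off : ∀ i → i ≢ a → f i ≡ 0
  off i i≢a = decidable-stable (f i ℕ.≟ 0) λ fi≢0 → i≢a (unique i a fi≢0 fa≢0)
... | no  none       =
  ≤-trans (≤-reflexive (∑-vanishing λ i → decidable-stable (f i ℕ.≟ 0) λ fi≢0 → none (i , fi≢0))) z≤n

∑-by-fibres : ∀ {m n} (π : Fin m → Fin n) (c : Fin m → ℕ) (f : Fin n → ℕ) →
  (∀ u → ∑[ v < m ] (𝟙 (π v ≟ u) * c v) ≤ f u) → ∑[ v < m ] c v ≤ ∑[ u < n ] f u
∑-by-fibres {m} {n} π c f fibre≤ = begin
  ∑[ v < m ] c v                            ≡⟨ sum-cong-≗ row ⟨
  ∑[ v < m ] ∑[ u < n ] (𝟙 (π v ≟ u) * c v) ≡⟨ ∑-comm (λ v u → 𝟙 (π v ≟ u) * c v) ⟩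
  ∑[ u < n ] ∑[ v < m ] (𝟙 (π v ≟ u) * c v) ≤⟨ ∑-mono-≤ fibre≤ ⟩
  ∑[ u < n ] f u                            ∎
  where
  open ≤-Reasoning
  row : ∀ v → ∑[ u < n ] (𝟙 (π v ≟ u) * c v) ≡ c v
  row v = begin-equality
    ∑[ u < n ] (𝟙 (π v ≟ u) * c v) ≡⟨ ∑-supported-at (π v) (λ u u≢πv → cong (_* c v) (𝟙-no (π v ≟ u) (u≢πv ∘ sym))) ⟩
    𝟙 (π v ≟ π v) * c v           ≡⟨ cong (_* c v) (𝟙-yes (π v ≟ π v) refl) ⟩
    1 * c v                       ≡⟨ *-identityˡ (c v) ⟩
    c v                           ∎

∑-𝟙-≤-injection : ∀ {n M} {P : Fin n → Set} (P? : ∀ i → Dec (P i)) (h : Fin n → ℕ) →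
  (∀ i → P i → h i < M) → (∀ i j → P i → P j → h i ≡ h j → i ≡ j) → ∑[ i < n ] 𝟙 (P? i) ≤ M
∑-𝟙-≤-injection {n} {M} {P} P? h h<M h-inj = begin
  ∑[ i < n ] 𝟙 (P? i)                   ≤⟨ ∑-mono-≤ hits ⟩
  ∑[ i < n ] ∑[ k < M ] 𝟙 (fibre? k i)  ≡⟨ ∑-comm (λ i k → 𝟙 (fibre? k i)) ⟩
  ∑[ k < M ] ∑[ i < n ] 𝟙 (fibre? k i)  ≤⟨ ∑-mono-≤ (λ k → ∑-≤1 (𝟙≤1 ∘ fibre? k) (single k)) ⟩
  ∑[ k < M ] 1                          ≡⟨ ∑-const-1 M ⟩
  M                                     ∎
  where
  open ≤-Reasoning
  fibre? : ∀ k i → Dec (P i × h i ≡ toℕ k)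
  fibre? k i = P? i ×-dec (h i ℕ.≟ toℕ k)
  hits : ∀ i → 𝟙 (P? i) ≤ ∑[ k < M ] 𝟙 (fibre? k i)
  hits i = hit (P? i)
    where
    hit : (d : Dec (P i)) → 𝟙 d ≤ ∑[ k < M ] 𝟙 (fibre? k i)
    hit (no _)  = z≤n
    hit (yes p) = ≤-trans (≤-reflexive (sym (𝟙-yes (fibre? k i) (p , sym (Fin.toℕ-fromℕ< (h<M i p))))))
                          (term≤∑ (λ k → 𝟙 (fibre? k i)) k)
      where k = fromℕ< (h<M i p)
  single : ∀ k i j → 𝟙 (fibre? k i) ≢ 0 → 𝟙 (fibre? k j) ≢ 0 → i ≡ j
  single k i j i∈ j∈ with 𝟙≢0⇒ (fibre? k i) i∈ | 𝟙≢0⇒ (fibre? k j) j∈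
  ... | pi , hi | pj , hj = h-inj i j pi pj (trans hi (sym hj))

1≤∣p∣⇒nonempty : ∀ {n} (p : Subset n) → 1 ≤ ∣ p ∣ → Nonempty p
1≤∣p∣⇒nonempty {n} p 1≤∣p∣ with nonempty? p
... | yes nonempty = nonempty
... | no  empty    = contradiction (trans (cong ∣_∣ (Empty-unique empty)) (∣⊥∣≡0 n)) (≢-sym (<⇒≢ 1≤∣p∣))

∣p∣≡∑𝟙 : ∀ {n} (p : Subset n) → ∣ p ∣ ≡ ∑[ i < n ] 𝟙 (i ∈? p)
∣p∣≡∑𝟙 []          = refl
∣p∣≡∑𝟙 (true  ∷ p) = cong suc (∣p∣≡∑𝟙 p)
∣p∣≡∑𝟙 (false ∷ p) = ∣p∣≡∑𝟙 p

sum-tabulate : ∀ {n} (f : Fin n → ℕ) → List.sum (tabulate f) ≡ ∑[ i < n ] f i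
sum-tabulate {zero}  f = refl
sum-tabulate {suc n} f = cong (f zero +_) (sum-tabulate (f ∘ suc))

sum-map-allFin : ∀ {n} (f : Fin n → ℕ) → List.sum (map f (allFin n)) ≡ ∑[ i < n ] f i
sum-map-allFin f = trans (cong List.sum (map-tabulate (λ i → i) f)) (sum-tabulate f)

module _ {n : ℕ} where

  open import Data.List.Membership.DecPropositional (_≟_ {n}) using () renaming (_∉_ to _∉ˡ_; _∈?_ to _∈ˡ?_)

  𝟙-∈-∷ : ∀ {x u : Fin n} {xs} → x ∉ˡ xs → 𝟙 (u ∈ˡ? x ∷ xs) ≡ 𝟙 (u ≟ x) + 𝟙 (u ∈ˡ? xs)
  𝟙-∈-∷ {x} {u} {xs} x∉xs = by-cases (u ≟ x)
    where
    by-cases : Dec (u ≡ x) → 𝟙 (u ∈ˡ? x ∷ xs) ≡ 𝟙 (u ≟ x) + 𝟙 (u ∈ˡ? xs)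
    by-cases (yes refl) = begin
      𝟙 (u ∈ˡ? x ∷ xs)         ≡⟨ 𝟙-yes (u ∈ˡ? x ∷ xs) (here refl) ⟩
      1 + 0                    ≡⟨ cong₂ _+_ (𝟙-yes (u ≟ x) refl) (𝟙-no (u ∈ˡ? xs) x∉xs) ⟨
      𝟙 (u ≟ x) + 𝟙 (u ∈ˡ? xs) ∎
      where open ≡-Reasoning
    by-cases (no u≢x) = begin
      𝟙 (u ∈ˡ? x ∷ xs)         ≡⟨ 𝟙-cong (λ { (here u≡x) → contradiction u≡x u≢x ; (there u∈xs) → u∈xs }) there
                                         (u ∈ˡ? x ∷ xs) (u ∈ˡ? xs) ⟩
      𝟙 (u ∈ˡ? xs)             ≡⟨ cong (_+ 𝟙 (u ∈ˡ? xs)) (𝟙-no (u ≟ x) u≢x) ⟨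
      𝟙 (u ≟ x) + 𝟙 (u ∈ˡ? xs) ∎
      where open ≡-Reasoning

  ∑-𝟙-∈ : ∀ {xs : List (Fin n)} → Unique xs → ∑[ u < n ] 𝟙 (u ∈ˡ? xs) ≡ length xs
  ∑-𝟙-∈ {[]}     []             = ∑-vanishing (λ u → 𝟙-no (u ∈ˡ? []) λ ())
  ∑-𝟙-∈ {x ∷ xs} (x∉xs ∷ uniq) = begin
    ∑[ u < n ] 𝟙 (u ∈ˡ? x ∷ xs)                     ≡⟨ sum-cong-≗ (λ u → 𝟙-∈-∷ {u = u} (All¬⇒¬Any x∉xs)) ⟩
    ∑[ u < n ] (𝟙 (u ≟ x) + 𝟙 (u ∈ˡ? xs))           ≡⟨ ∑-distrib-+ (λ u → 𝟙 (u ≟ x)) (λ u → 𝟙 (u ∈ˡ? xs)) ⟩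
    ∑[ u < n ] 𝟙 (u ≟ x) + ∑[ u < n ] 𝟙 (u ∈ˡ? xs)  ≡⟨ cong₂ _+_ (trans (∑-supported-at x (λ u → 𝟙-no (u ≟ x))) (𝟙-yes (x ≟ x) refl)) (∑-𝟙-∈ uniq) ⟩
    suc (length xs)                               ∎
    where open ≡-Reasoning

  length≤∑ : ∀ {xs : List (Fin n)} (g : Fin n → ℕ) → Unique xs → (∀ {u} → u ∈ˡ xs → 1 ≤ g u) →
             length xs ≤ ∑[ u < n ] g u
  length≤∑ {xs} g uniq 1≤g = begin
    length xs                  ≡⟨ ∑-𝟙-∈ uniq ⟨
    ∑[ u < n ] 𝟙 (u ∈ˡ? xs)    ≤⟨ ∑-mono-≤ (λ u → bound (u ∈ˡ? xs)) ⟩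
    ∑[ u < n ] g u             ∎
    where
    open ≤-Reasoning
    bound : ∀ {u} (d : Dec (u ∈ˡ xs)) → 𝟙 d ≤ g u
    bound (yes u∈xs) = 1≤g u∈xs
    bound (no _)     = z≤n

-- Walks, distance and degree

-- Defs computes `dist` by a private search; the metavariable `leastUpTo` is solved by
-- unification with that search in `dist-unfold`, so the search can be reasoned about for an
-- arbitrary predicate.
mutual
  leastUpTo : ∀ {N} → Graph N → (ℕ → Bool) → ℕ → ℕ
  leastUpTo = _

  dist-unfold : ∀ {N} (G : Graph (suc N)) (u v : Fin (suc N)) →
    dist G u v ≡ (if reach G 0 u v then 0 else suc (leastUpTo G (λ k → reach G (suc k) u v) N))
  dist-unfold {N} G u v with reach G 0 u v | (λ k → reach G (suc k) u v)
  ... | _ | _ with suc N | G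
  ... | _ | _ = refl

1≤dist : ∀ {N} (G : Graph N) {u v : Fin N} → u ≢ v → 1 ≤ dist G u v
1≤dist {suc N} G {u} {v} u≢v rewrite dist-unfold G u v | dec-false (u ≟ v) u≢v = s≤s z≤n

≤-foldr-⊔ : ∀ {A : Set} (g : A → ℕ) {x} xs → x ∈ˡ xs → g x ≤ foldr _⊔_ 0 (map g xs)
≤-foldr-⊔ g (y ∷ ys) (here refl) = m≤m⊔n (g y) _
≤-foldr-⊔ g (y ∷ ys) (there x∈) = ≤-trans (≤-foldr-⊔ g ys x∈) (m≤n⊔m (g y) _)

module GraphProperties {n : ℕ} (G : Graph n) where

  Adj-sym : ∀ {u v} → Adj G u v → Adj G v u
  Adj-sym {u} {v} = subst T (symm G u v)

  Adj-irrefl : ∀ {u v} → Adj G u v → u ≢ v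
  Adj-irrefl {u} uu refl = subst T (irrefl G u) uu

  record Reach (k : ℕ) (u v : Fin n) : Set where
    constructor reaches
    field reached : T (reach G k u v)

  open Reach

  reach-refl : ∀ u → Reach 0 u u
  reach-refl u = reaches (from T-≡ (dec-true (u ≟ u) refl))

  reach-suc : ∀ {k u v} → Reach k u v → Reach (suc k) u v
  reach-suc r = reaches (from T-∨ (inj₁ (reached r)))

  reach-mono : ∀ {k l u v} → k ≤ l → Reach k u v → Reach l u v
  reach-mono = go ∘ ≤⇒≤′
    where
    go : ∀ {k l u v} → k ≤′ l → Reach k u v → Reach l u v
    go (≤′-reflexive refl) r = r
    go (≤′-step k≤l)       r = reach-suc (go k≤l r)

  reach-step : ∀ {k u w v} → Adj G u w → Reach k w v → Reach (suc k) u v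
  reach-step {w = w} uw r =
    reaches (from T-∨ (inj₂ (any⁺ _ (lose (∈-allFin w) (from T-∧ (uw , reached r))))))

  reach-edge : ∀ {u v} → Adj G u v → Reach 1 u v
  reach-edge {v = v} uv = reach-step uv (reach-refl v)

  reach-split : ∀ {k u v} → Reach (suc k) u v → Reach k u v ⊎ ∃ λ w → Adj G u w × Reach k w v
  reach-split {k} {u} {v} (reaches r) with to T-∨ r
  ... | inj₁ r′ = inj₁ (reaches r′)
  ... | inj₂ r′ with satisfied (any⁻ _ (allFin n) r′)
  ... | w , uw∧r = inj₂ (w , proj₁ (to T-∧ uw∧r) , reaches (proj₂ (to T-∧ uw∧r)))

  reach-zero : ∀ {u v} → Reach 0 u v → u ≡ v
  reach-zero {u} {v} (reaches r) with u ≟ v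
  ... | yes u≡v = u≡v

  reach-trans : ∀ a {b u v w} → Reach a u v → Reach b v w → Reach (a + b) u w
  reach-trans zero    {b} {w = w} uv vw = subst (λ x → Reach b x w) (sym (reach-zero uv)) vw
  reach-trans (suc a) uv vw with reach-split uv
  ... | inj₁ uv′            = reach-suc (reach-trans a uv′ vw)
  ... | inj₂ (x , ux , xv) = reach-step ux (reach-trans a xv vw)

  reach-sym : ∀ k {u v} → Reach k u v → Reach k v u
  reach-sym zero    {u} uv = subst (λ x → Reach 0 x u) (reach-zero uv) (reach-refl u)
  reach-sym (suc k) {u} {v} uv with reach-split uv
  ... | inj₁ uv′           = reach-suc (reach-sym k uv′)
  ... | inj₂ (x , ux , xv) =
    subst (λ j → Reach j v u) (+-comm k 1) (reach-trans k (reach-sym k xv) (reach-edge (Adj-sym ux)))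

  reach-preserves : (P : Fin n → Set) → (∀ {u w} → P u → Adj G u w → P w) →
                    ∀ k {u v} → P u → Reach k u v → P v
  reach-preserves P closed zero    pu uv = subst P (reach-zero uv) pu
  reach-preserves P closed (suc k) pu uv with reach-split uv
  ... | inj₁ uv′           = reach-preserves P closed k pu uv′
  ... | inj₂ (x , ux , xv) = reach-preserves P closed k (closed pu ux) xv

  1≤reach : ∀ k {u v} → Reach k u v → u ≢ v → 1 ≤ k
  1≤reach zero    uv u≢v = contradiction (reach-zero uv) u≢v
  1≤reach (suc k) uv u≢v = s≤s z≤n

  2≤reach : ∀ k {u v} → Reach k u v → u ≢ v → ¬ Adj G u v → 2 ≤ k
  2≤reach zero          uv u≢v ¬uv = contradiction (reach-zero uv) u≢v
  2≤reach (suc zero)    uv u≢v ¬uv with reach-split uv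
  ... | inj₁ uv′           = contradiction (reach-zero uv′) u≢v
  ... | inj₂ (x , ux , xv) = contradiction (subst (Adj G _) (reach-zero xv) ux) ¬uv
  2≤reach (suc (suc k)) uv u≢v ¬uv = s≤s (s≤s z≤n)

  reach-neighbour : ∀ k {u v} → Reach k u v → u ≢ v → ∃ (Adj G u)
  reach-neighbour zero    uv u≢v = contradiction (reach-zero uv) u≢v
  reach-neighbour (suc k) uv u≢v with reach-split uv
  ... | inj₁ uv′          = reach-neighbour k uv′ u≢v
  ... | inj₂ (x , ux , _) = x , ux

  linked⇒reach : ∀ x xs → Linked (Adj G) (x ∷ xs) → Reach (length xs) x (lastOr G x xs)
  linked⇒reach x []       _         = reach-refl x
  linked⇒reach x (y ∷ ys) (xy ∷ l) = reach-step xy (linked⇒reach y ys l)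

  least≤ : ∀ q m k → q k ≡ true → leastUpTo G q m ≤ k
  least≤ q zero    k       qk = z≤n
  least≤ q (suc m) k       qk with q 0 in q0
  ... | true                  = z≤n
  least≤ q (suc m) zero    qk | false = contradiction (trans (sym q0) qk) λ ()
  least≤ q (suc m) (suc k) qk | false = s≤s (least≤ (q ∘ suc) m k qk)

  least-holds : ∀ q m → leastUpTo G q m < m → q (leastUpTo G q m) ≡ true
  least-holds q (suc m) lt with q 0 in q0
  ... | true  = q0
  ... | false = least-holds (q ∘ suc) m (≤-pred lt)

  dist≤ : ∀ {k u v} → Reach k u v → dist G u v ≤ k
  dist≤ {k} {u} {v} (reaches r) = least≤ (λ j → reach G j u v) n k (to T-≡ r)

  reach-dist : ∀ {u v} → dist G u v < n → Reach (dist G u v) u v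
  reach-dist {u} {v} lt = reaches (from T-≡ (least-holds (λ j → reach G j u v) n lt))

  dist-refl : ∀ u → dist G u u ≡ 0
  dist-refl u = n≤0⇒n≡0 (dist≤ (reach-refl u))

  dist≤ecc : ∀ v y → dist G v y ≤ ecc G v
  dist≤ecc v y = ≤-foldr-⊔ (dist G v) (allFin n) (∈-allFin y)

  module _ (connected : Connected G) where

    dist<n : ∀ u v → dist G u v < n
    dist<n u v with connected u v
    ... | x ∷ xs , refl , refl , uniq , linked = begin-strict
      dist G x (lastOr G x xs) ≤⟨ dist≤ (linked⇒reach x xs linked) ⟩
      length xs                <⟨ n<1+n (length xs) ⟩
      length (x ∷ xs)          ≤⟨ length≤∑ (λ _ → 1) uniq (λ _ → ≤-refl) ⟩
      ∑[ _ < n ] 1             ≡⟨ ∑-const-1 n ⟩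
      n                        ∎
      where open ≤-Reasoning

    reach-by-dist : ∀ u v → Reach (dist G u v) u v
    reach-by-dist u v = reach-dist (dist<n u v)

  adj𝟙 : Fin n → Fin n → ℕ
  adj𝟙 v u = if adj G v u then 1 else 0

  deg≡∑ : ∀ v → deg G v ≡ ∑[ u < n ] adj𝟙 v u
  deg≡∑ v = sum-map-allFin (adj𝟙 v)

  length≤deg : ∀ {v xs} → Unique xs → (∀ {u} → u ∈ˡ xs → Adj G v u) → length xs ≤ deg G v
  length≤deg {v} uniq nbr = subst (_ ≤_) (sym (deg≡∑ v)) (length≤∑ (adj𝟙 v) uniq (1≤adj𝟙 ∘ nbr))
    where
    1≤adj𝟙 : ∀ {u} → Adj G v u → 1 ≤ adj𝟙 v u
    1≤adj𝟙 {u} vu with adj G v u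
    ... | true = ≤-refl

  deg≤∑ : ∀ {v} (g : Fin n → ℕ) → (∀ {u} → Adj G v u → 1 ≤ g u) → deg G v ≤ ∑[ u < n ] g u
  deg≤∑ {v} g 1≤g = subst (_≤ _) (sym (deg≡∑ v)) (∑-mono-≤ adj𝟙≤g)
    where
    adj𝟙≤g : ∀ u → adj𝟙 v u ≤ g u
    adj𝟙≤g u with adj G v u in vu
    ... | true  = 1≤g (from T-≡ vu)
    ... | false = z≤n

  1≤deg : ∀ {v a} → Adj G v a → 1 ≤ deg G v
  1≤deg va = length≤deg ([] ∷ []) λ { (here refl) → va }

  2≤deg : ∀ {v a b} → a ≢ b → Adj G v a → Adj G v b → 2 ≤ deg G v
  2≤deg a≢b va vb = length≤deg ((a≢b ∷ []) ∷ [] ∷ []) λ { (here refl) → va ; (there (here refl)) → vb }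

  3≤deg : ∀ {v a b c} → a ≢ b → a ≢ c → b ≢ c → Adj G v a → Adj G v b → Adj G v c → 3 ≤ deg G v
  3≤deg a≢b a≢c b≢c va vb vc = length≤deg ((a≢b ∷ a≢c ∷ []) ∷ (b≢c ∷ []) ∷ [] ∷ [])
    λ { (here refl) → va ; (there (here refl)) → vb ; (there (there (here refl))) → vc }

  neighbour : ∀ {v} → 1 ≤ deg G v → ∃ (Adj G v)
  neighbour {v} 1≤deg with Fin.any? (λ u → T? (adj G v u))
  ... | yes nbr = nbr
  ... | no none = contradiction (≤-trans 1≤deg deg≤0) λ ()
    where
    deg≤0 : deg G v ≤ 0
    deg≤0 = ≤-trans (deg≤∑ (λ _ → 0) λ {u} vu → contradiction (u , vu) none) (≤-reflexive (∑-vanishing {n} λ _ → refl))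

  neighbour-other-than : ∀ {v} → 2 ≤ deg G v → ∀ a → ∃ λ u → Adj G v u × u ≢ a
  neighbour-other-than {v} 2≤deg a with Fin.any? (λ u → T? (adj G v u) ×-dec ¬? (u ≟ a))
  ... | yes nbr = nbr
  ... | no none = contradiction (≤-trans 2≤deg (deg≤∑ (λ u → 𝟙 (u ≟ a)) at-a)) (<⇒≱ (s≤s (≤-reflexive ∑𝟙≡1)))
    where
    at-a : ∀ {u} → Adj G v u → 1 ≤ 𝟙 (u ≟ a)
    at-a {u} vu = ≤-reflexive (sym (𝟙-yes (u ≟ a) (decidable-stable (u ≟ a) λ u≢a → none (u , vu , u≢a))))
    ∑𝟙≡1 : ∑[ u < n ] 𝟙 (u ≟ a) ≡ 1
    ∑𝟙≡1 = trans (∑-supported-at a (λ u → 𝟙-no (u ≟ a))) (𝟙-yes (a ≟ a) refl)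

  leaf-neighbour-unique : ∀ {v a u} → deg G v ≡ 1 → Adj G v a → Adj G v u → u ≡ a
  leaf-neighbour-unique {a = a} {u} deg≡1 va vu =
    decidable-stable (u ≟ a) λ u≢a → contradiction (subst (2 ≤_) deg≡1 (2≤deg u≢a vu va)) λ { (s≤s ()) }

  deg≤2-neighbours : ∀ {v a b u} → deg G v ≤ 2 → a ≢ b → Adj G v a → Adj G v b → Adj G v u → u ≡ a ⊎ u ≡ b
  deg≤2-neighbours {a = a} {b} {u} deg≤2 a≢b va vb vu with u ≟ a | u ≟ b
  ... | yes u≡a | _       = inj₁ u≡a
  ... | no _    | yes u≡b = inj₂ u≡b
  ... | no u≢a  | no u≢b  = contradiction (≤-trans (3≤deg a≢b (u≢a ∘ sym) (u≢b ∘ sym) va vb vu) deg≤2) λ { (s≤s (s≤s ())) }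

  nextAlong : Fin n → Fin n → Fin n
  nextAlong p c with Fin.any? (λ u → T? (adj G c u) ×-dec ¬? (u ≟ p))
  ... | yes (u , _) = u
  ... | no _        = p

  nextAlong-spec : ∀ p c → (Adj G c (nextAlong p c) × nextAlong p c ≢ p)
                         ⊎ ((∀ {u} → Adj G c u → u ≡ p) × nextAlong p c ≡ p)
  nextAlong-spec p c with Fin.any? (λ u → T? (adj G c u) ×-dec ¬? (u ≟ p))
  ... | yes (u , cu , u≢p) = inj₁ (cu , u≢p)
  ... | no none             = inj₂ ((λ {u} cu → decidable-stable (u ≟ p) λ u≢p → none (u , cu , u≢p)) , refl)

  Int⇒branch⊎Wint : ∀ {v} → InInt G v → IsBranch G v ⊎ InWint G v
  Int⇒branch⊎Wint (inj₁ (br , _))        = inj₁ br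
  Int⇒branch⊎Wint (inj₂ (inj₁ (br , _))) = inj₁ br
  Int⇒branch⊎Wint (inj₂ (inj₂ wint))     = inj₂ wint

  Int⇒1≤deg : ∀ {v} → InInt G v → 1 ≤ deg G v
  Int⇒1≤deg int with Int⇒branch⊎Wint int
  ... | inj₁ br            = ≤-trans (s≤s z≤n) br
  ... | inj₂ (deg≡2 , _)   = subst (1 ≤_) (sym deg≡2) (s≤s z≤n)

-- Endpaths

module Endpaths {n : ℕ} (G : Graph n) (connected : Connected G) (b₀ : Fin n) (b₀-branch : IsBranch G b₀) where

  open GraphProperties G

  branch? : ∀ v → Dec (IsBranch G v)
  branch? v = 3 ℕ.≤? deg G v

  nearestBranch : Fin n → Fin n
  nearestBranch v = argmin (dist G v) b₀ (filter branch? (allFin n))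

  nearestBranch-isBranch : ∀ v → IsBranch G (nearestBranch v)
  nearestBranch-isBranch v = argmin-all (dist G v) b₀-branch (all-filter branch? (allFin n))

  nearestBranch-nearest : ∀ v {b} → IsBranch G b → dist G v (nearestBranch v) ≤ dist G v b
  nearestBranch-nearest v {b} br =
    All.lookup (f[argmin]≤f[xs] b₀ (filter branch? (allFin n))) (∈-filter⁺ branch? (∈-allFin b) br)

  branchDist : Fin n → ℕ
  branchDist v = dist G v (nearestBranch v)

  module Endpath (l : Fin n) (leaf : IsLeaf G l) where

    b : Fin n
    b = nearestBranch l

    m : ℕ
    m = branchDist l

    b-branch : IsBranch G b
    b-branch = nearestBranch-isBranch l

    l≢b : l ≢ b
    l≢b l≡b = contradiction (subst (3 ≤_) leaf (subst (λ v → 3 ≤ deg G v) (sym l≡b) b-branch)) λ { (s≤s ()) }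

    1≤m : 1 ≤ m
    1≤m = 1≤dist G l≢b

    -- x₀ = l and x_{i+2} is a neighbour of x_{i+1} other than x_i (or x_i if there is none);
    -- x₀, …, x_m turns out to be the endpath of l.
    steps : ℕ → Fin n × Fin n
    steps zero    = l , nextAlong l l
    steps (suc i) = proj₂ (steps i) , nextAlong (proj₁ (steps i)) (proj₂ (steps i))

    x : ℕ → Fin n
    x i = proj₁ (steps i)

    x-adj : ∀ i → Adj G (x i) (x (suc i))
    x-adj zero with nextAlong-spec l l
    ... | inj₁ (l-next , _) = l-next
    ... | inj₂ (only-l , _) with neighbour (≤-reflexive (sym leaf))
    ...   | u , lu = contradiction (only-l lu) (Adj-irrefl lu ∘ sym)
    x-adj (suc j) with nextAlong-spec (x j) (x (suc j))
    ... | inj₁ (forward , _)  = forward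
    ... | inj₂ (_ , backward) = subst (Adj G (x (suc j))) (sym backward) (Adj-sym (x-adj j))

    reach-x : ∀ i → Reach i l (x i)
    reach-x zero    = reach-refl l
    reach-x (suc i) = subst (λ k → Reach k l (x (suc i))) (+-comm i 1)
                            (reach-trans i (reach-x i) (reach-edge (x-adj i)))

    dist-x≤ : ∀ i → dist G l (x i) ≤ i
    dist-x≤ i = dist≤ (reach-x i)

    x-not-branch : ∀ {i} → i < m → ¬ IsBranch G (x i)
    x-not-branch {i} i<m br = <-irrefl refl (≤-<-trans (≤-trans (nearestBranch-nearest l br) (dist-x≤ i)) i<m)

    deg-x≤2 : ∀ {i} → i < m → deg G (x i) ≤ 2
    deg-x≤2 i<m = ≤-pred (≰⇒> (x-not-branch i<m))

    l-neighbour : ∀ {u} → Adj G l u → u ≡ x 1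
    l-neighbour = leaf-neighbour-unique leaf (x-adj 0)

    x-neighbours : ∀ {j u} → suc j < m → Adj G (x (suc j)) u → u ≡ x j ⊎ u ≡ x (suc (suc j))
    x-neighbours {j} sj<m xu with nextAlong-spec (x j) (x (suc j))
    ... | inj₁ (forward , x₂≢x₀) = deg≤2-neighbours (deg-x≤2 sj<m) (x₂≢x₀ ∘ sym) (Adj-sym (x-adj j)) forward xu
    ... | inj₂ (only-back , _)   = inj₁ (only-back xu)

    -- A walk of length t from a vertex x_i, i < m, stays among x₀, …, x_{m-1} or passes through x_m.
    ReachedBy : ℕ → Fin n → Set
    ReachedBy t v = (∃ λ j → j < m × v ≡ x j × j ≤ t) ⊎ (m ≤ t × Reach (t ∸ m) (x m) v)

    reachedBy-mono : ∀ {t t′ v} → t ≤ t′ → ReachedBy t v → ReachedBy t′ v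
    reachedBy-mono t≤t′ (inj₁ (j , j<m , v≡xj , j≤t)) = inj₁ (j , j<m , v≡xj , ≤-trans j≤t t≤t′)
    reachedBy-mono t≤t′ (inj₂ (m≤t , r))              = inj₂ (≤-trans m≤t t≤t′ , reach-mono (∸-monoˡ-≤ m t≤t′) r)

    reach⇒reachedBy : ∀ k i → i < m → ∀ {v} → Reach k (x i) v → ReachedBy (i + k) v
    reach⇒reachedBy zero    i i<m r = inj₁ (i , i<m , sym (reach-zero r) , m≤m+n i 0)
    reach⇒reachedBy (suc k) i i<m {v} r with reach-split r
    ... | inj₁ r′            = reachedBy-mono (+-monoʳ-≤ i (n≤1+n k)) (reach⇒reachedBy k i i<m r′)
    ... | inj₂ (w , xw , wv) = via-neighbour i i<m xw wv
      where
      forward : ∀ i → i < m → Reach k (x (suc i)) v → ReachedBy (i + suc k) v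
      forward i i<m r with m≤n⇒m<n∨m≡n i<m
      ... | inj₁ si<m = subst (λ t → ReachedBy t v) (sym (+-suc i k)) (reach⇒reachedBy k (suc i) si<m r)
      ... | inj₂ si≡m = inj₂ (subst (_≤ i + suc k) si≡m (≤-trans (m≤m+n (suc i) k) (≤-reflexive (sym (+-suc i k))))
                             , subst₂ (λ t y → Reach t y v) (sym i+sk∸m≡k) (cong x si≡m) r)
        where
        i+sk∸m≡k : i + suc k ∸ m ≡ k
        i+sk∸m≡k = trans (cong (i + suc k ∸_) (sym si≡m)) (trans (cong (_∸ suc i) (+-suc i k)) (m+n∸m≡n (suc i) k))
      via-neighbour : ∀ i → i < m → ∀ {w} → Adj G (x i) w → Reach k w v → ReachedBy (i + suc k) v
      via-neighbour zero    i<m  xw r = forward zero i<m (subst (λ w → Reach k w v) (l-neighbour xw) r)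
      via-neighbour (suc j) sj<m xw r with x-neighbours sj<m xw
      ... | inj₁ w≡xj   = reachedBy-mono (≤-trans (n≤1+n (j + k)) (s≤s (+-monoʳ-≤ j (n≤1+n k))))
                                         (reach⇒reachedBy k j (<-trans (n<1+n j) sj<m) (subst (λ w → Reach k w v) w≡xj r))
      ... | inj₂ w≡xssj = forward (suc j) sj<m (subst (λ w → Reach k w v) w≡xssj r)

    reach-b : Reach m l b
    reach-b = reach-by-dist connected l b

    x-m≡b : x m ≡ b
    x-m≡b with reach⇒reachedBy m 0 1≤m reach-b
    ... | inj₁ (j , j<m , b≡xj , _) = contradiction (subst (IsBranch G) b≡xj b-branch) (x-not-branch j<m)
    ... | inj₂ (_ , r)              = reach-zero (subst (λ t → Reach t (x m) b) (n∸n≡0 m) r)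

    -- If x_{j+1} had no neighbour besides x_j, the walk from l to b could never leave x₀ … x_{j+1}.
    dead-end : ∀ j → suc j < m → ¬ (∀ {u} → Adj G (x (suc j)) u → u ≡ x j)
    dead-end j sj<m only-back with reach-preserves Prefix closed m (0 , z≤n , refl) reach-b
      where
      Prefix : Fin n → Set
      Prefix v = ∃ λ t → t ≤ suc j × v ≡ x t
      closed : ∀ {u w} → Prefix u → Adj G u w → Prefix w
      closed (zero , _ , refl) uw = 1 , s≤s z≤n , l-neighbour uw
      closed (suc t , st≤sj , refl) uw with m≤n⇒m<n∨m≡n st≤sj
      ... | inj₁ st<sj with x-neighbours (<-trans st<sj sj<m) uw
      ...   | inj₁ w≡xt   = t , ≤-trans (n≤1+n t) st≤sj , w≡xt
      ...   | inj₂ w≡xsst = suc (suc t) , st<sj , w≡xsst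
      closed (suc t , st≤sj , refl) uw | inj₂ st≡sj with suc-injective st≡sj
      ... | refl = j , n≤1+n j , only-back uw
    ... | t , t≤sj , b≡xt = x-not-branch (≤-<-trans t≤sj sj<m) (subst (IsBranch G) b≡xt b-branch)

    no-backtrack : ∀ {a} → suc a < m → x (suc (suc a)) ≢ x a
    no-backtrack {a} sa<m x₂≡x₀ with nextAlong-spec (x a) (x (suc a))
    ... | inj₁ (_ , x₂≢x₀)    = x₂≢x₀ x₂≡x₀
    ... | inj₂ (only-back , _) = dead-end a sa<m only-back

    no-return : ∀ j → suc j < m → (∀ t → t ≤ j → dist G l (x t) ≡ t) → ∀ t → t ≤ j → x (suc j) ≢ x t
    no-return j sj<m exact t t≤j x≡ with t ℕ.≟ j
    ... | yes refl = Adj-irrefl (x-adj j) (sym x≡)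
    no-return zero    sj<m exact zero t≤j x≡ | no t≢j = t≢j refl
    no-return (suc j) sj<m exact zero t≤j x≡ | no t≢j
      with trans (sym (exact (suc j) ≤-refl))
                 (trans (cong (dist G l) (l-neighbour (Adj-sym (subst (Adj G (x (suc j))) x≡ (x-adj (suc j))))))
                        (exact 1 (s≤s z≤n)))
    ... | refl = no-backtrack (<-trans (s≤s (s≤s z≤n)) sj<m) x≡
    no-return j sj<m exact (suc t) t≤j x≡ | no t≢j
      with x-neighbours (≤-<-trans t≤j (<-trans (n<1+n j) sj<m)) (Adj-sym (subst (Adj G (x j)) x≡ (x-adj j)))
    ... | inj₁ xj≡xt = <-irrefl refl (subst (λ s → suc s ≤ j) (sym j≡t) t≤j)
      where
      j≡t : j ≡ t
      j≡t = trans (sym (exact j ≤-refl)) (trans (cong (dist G l) xj≡xt) (exact t (≤-trans (n≤1+n t) t≤j)))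
    ... | inj₂ xj≡xsst with trans (sym (exact j ≤-refl)) (trans (cong (dist G l) xj≡xsst) (exact (suc (suc t)) (≤∧≢⇒< t≤j t≢j)))
    ... | refl = no-backtrack (<-trans (n<1+n _) sj<m) x≡

    dist-x-prefix : ∀ j → j < m → ∀ t → t ≤ j → dist G l (x t) ≡ t
    dist-x-prefix zero    j<m  zero z≤n = dist-refl l
    dist-x-prefix (suc j) sj<m t t≤sj with m≤n⇒m<n∨m≡n t≤sj
    ... | inj₁ t<sj = dist-x-prefix j (<-trans (n<1+n j) sj<m) t (≤-pred t<sj)
    ... | inj₂ refl = ≤-antisym (dist-x≤ (suc j)) (≮⇒≥ (shortcut-impossible ∘ ≤-pred))
      where
      shortcut-impossible : dist G l (x (suc j)) ≤ j → ⊥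
      shortcut-impossible d≤j with reach⇒reachedBy _ 0 1≤m (reach-by-dist connected l (x (suc j)))
      ... | inj₂ (m≤d , _)             = <-irrefl refl (≤-<-trans (≤-trans m≤d d≤j) (<-trans (n<1+n j) sj<m))
      ... | inj₁ (t , _ , x≡xt , t≤d) = no-return j sj<m (dist-x-prefix j (<-trans (n<1+n j) sj<m)) t (≤-trans t≤d d≤j) x≡xt

    dist-x : ∀ t → t ≤ m → dist G l (x t) ≡ t
    dist-x t t≤m with m≤n⇒m<n∨m≡n t≤m
    ... | inj₁ t<m = dist-x-prefix t t<m t ≤-refl
    ... | inj₂ refl = cong (dist G l) x-m≡b

    x-injective : ∀ {i j} → i ≤ m → j ≤ m → x i ≡ x j → i ≡ j
    x-injective {i} {j} i≤m j≤m xi≡xj = trans (sym (dist-x i i≤m)) (trans (cong (dist G l) xi≡xj) (dist-x j j≤m))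

    deg-x≡2 : ∀ {j} → suc j < m → deg G (x (suc j)) ≡ 2
    deg-x≡2 {j} sj<m = ≤-antisym (deg-x≤2 sj<m) (2≤deg xj≢xssj (Adj-sym (x-adj j)) (x-adj (suc j)))
      where
      xj≢xssj : x j ≢ x (suc (suc j))
      xj≢xssj xj≡xssj with x-injective (≤-trans (n≤1+n j) (≤-trans (n≤1+n (suc j)) sj<m)) sj<m xj≡xssj
      ... | ()

    near⇒on-endpath : ∀ {v} → dist G l v < m → v ≡ x (dist G l v)
    near⇒on-endpath {v} d<m with reach⇒reachedBy _ 0 1≤m (reach-by-dist connected l v)
    ... | inj₂ (m≤d , _)             = contradiction d<m (≤⇒≯ m≤d)
    ... | inj₁ (j , j<m , v≡xj , _) = subst (λ t → v ≡ x t) (sym (trans (cong (dist G l) v≡xj) (dist-x j (<⇒≤ j<m)))) v≡xj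

    walk-from-leaf : ∀ k {v} → Reach k l v → (∃ λ j → j < m × v ≡ x j) ⊎ (m ≤ k × Reach (k ∸ m) b v)
    walk-from-leaf k r with reach⇒reachedBy k 0 1≤m r
    ... | inj₁ (j , j<m , v≡xj , _) = inj₁ (j , j<m , v≡xj)
    ... | inj₂ (m≤k , r′)           = inj₂ (m≤k , subst (λ y → Reach (k ∸ m) y _) x-m≡b r′)

    endpath : ℕ → List (Fin n)
    endpath zero    = x 0 ∷ []
    endpath (suc j) = x (suc j) ∷ endpath j

    endpath-last : ∀ j a → lastOr G a (endpath j) ≡ l
    endpath-last zero    a = refl
    endpath-last (suc j) a = endpath-last j (x (suc j))

    ∈-endpath⁻ : ∀ j {v} → v ∈ˡ endpath j → ∃ λ t → t ≤ j × v ≡ x t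
    ∈-endpath⁻ zero    (here v≡x₀)  = 0 , z≤n , v≡x₀
    ∈-endpath⁻ (suc j) (here v≡xsj) = suc j , ≤-refl , v≡xsj
    ∈-endpath⁻ (suc j) (there v∈)   with ∈-endpath⁻ j v∈
    ... | t , t≤j , v≡xt = t , ≤-trans t≤j (n≤1+n j) , v≡xt

    ∈-endpath⁺ : ∀ j t → t ≤ j → x t ∈ˡ endpath j
    ∈-endpath⁺ zero    zero    _ = here refl
    ∈-endpath⁺ (suc j) t t≤sj with t ℕ.≟ suc j
    ... | yes refl = here refl
    ... | no t≢sj  = there (∈-endpath⁺ j t (≤-pred (≤∧≢⇒< t≤sj t≢sj)))

    endpath-unique : ∀ j → j ≤ m → Unique (endpath j)
    endpath-unique zero    _    = [] ∷ []
    endpath-unique (suc j) sj≤m = All.tabulate fresh ∷ endpath-unique j (≤-trans (n≤1+n j) sj≤m)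
      where
      fresh : ∀ {v} → v ∈ˡ endpath j → x (suc j) ≢ v
      fresh v∈ xsj≡v with ∈-endpath⁻ j v∈
      ... | t , t≤j , refl =
        <-irrefl refl (subst (_≤ j) (sym (x-injective sj≤m (≤-trans t≤j (≤-trans (n≤1+n j) sj≤m)) xsj≡v)) t≤j)

    endpath-linked : ∀ j → Linked (Adj G) (endpath j)
    endpath-linked zero          = [-]
    endpath-linked (suc zero)    = Adj-sym (x-adj 0) ∷ [-]
    endpath-linked (suc (suc j)) = Adj-sym (x-adj (suc j)) ∷ endpath-linked (suc j)

    endpath-isPath : ∀ j → j ≤ m → IsPath G (x j) l (endpath j)
    endpath-isPath zero    j≤m = refl , refl , endpath-unique 0 j≤m , [-]
    endpath-isPath (suc j) j≤m = refl , endpath-last j (x (suc j)) , endpath-unique (suc j) j≤m , endpath-linked (suc j)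

    endpath-internal : ∀ j → j ≤ m → Internal G (Deg2 G) (endpath j)
    endpath-internal zero                _   = _
    endpath-internal (suc zero)          _   = _
    endpath-internal (suc (suc zero))    j≤m = deg-x≡2 j≤m , _
    endpath-internal (suc (suc (suc j))) j≤m = deg-x≡2 j≤m , endpath-internal (suc (suc j)) (≤-trans (n≤1+n _) j≤m)

    endpath-head : ∀ j {y ys} → y ∷ ys ≡ endpath j → y ≡ x j
    endpath-head zero    refl = refl
    endpath-head (suc j) refl = refl

    l∈L[b] : InLeafSet G b l
    l∈L[b] = leaf , endpath m , subst (λ y → IsPath G y l (endpath m)) x-m≡b (endpath-isPath m ≤-refl)
                  , endpath-internal m ≤-refl

    x∈Wext : ∀ {j} → suc j < m → InWext G (x (suc j))
    x∈Wext {j} sj<m = deg-x≡2 sj<m , endpath (suc j)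
                    , (x (suc j) , l , endpath-isPath (suc j) (<⇒≤ sj<m) , leaf , endpath-internal (suc j) (<⇒≤ sj<m))
                    , here refl

    b-not-deg2 : ¬ Deg2 G b
    b-not-deg2 deg≡2 = contradiction (subst (3 ≤_) deg≡2 b-branch) λ { (s≤s (s≤s ())) }

    -- d stands for the vertex preceding z, so that z counts as an internal vertex.
    into-leaf-along-endpath : ∀ d z zs → Linked (Adj G) (z ∷ zs) → Unique (z ∷ zs) → lastOr G z zs ≡ l →
                              Internal G (Deg2 G) (d ∷ z ∷ zs) → ∃ λ j → j < m × z ∷ zs ≡ endpath j
    into-leaf-along-endpath d z []       _          _           z≡l _ = 0 , 1≤m , cong (_∷ []) z≡l
    into-leaf-along-endpath d z (y ∷ ys) (zy ∷ lk) (z∉ ∷ uniq) last (deg-z , int)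
      with into-leaf-along-endpath z y ys lk uniq last int
    ... | j , j<m , y∷ys≡ = extend j j<m y∷ys≡ (subst (λ w → Adj G w z) (endpath-head j y∷ys≡) (Adj-sym zy))
      where
      extend : ∀ j → j < m → y ∷ ys ≡ endpath j → Adj G (x j) z → ∃ λ j′ → j′ < m × z ∷ y ∷ ys ≡ endpath j′
      extend zero j<m y∷ys≡ x₀z with m≤n⇒m<n∨m≡n 1≤m
      ... | inj₁ 1<m = 1 , 1<m , cong₂ _∷_ (l-neighbour x₀z) y∷ys≡
      ... | inj₂ 1≡m = contradiction (subst (Deg2 G) (trans (l-neighbour x₀z) (trans (cong x 1≡m) x-m≡b)) deg-z) b-not-deg2
      extend (suc j) sj<m y∷ys≡ xz with x-neighbours sj<m xz
      ... | inj₁ z≡xj   = contradiction z≡xj (All.lookup z∉ (subst (x j ∈ˡ_) (sym y∷ys≡) (∈-endpath⁺ (suc j) j (n≤1+n j))))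
      ... | inj₂ z≡xssj with m≤n⇒m<n∨m≡n sj<m
      ...   | inj₁ ssj<m = suc (suc j) , ssj<m , cong₂ _∷_ z≡xssj y∷ys≡
      ...   | inj₂ ssj≡m = contradiction (subst (Deg2 G) (trans z≡xssj (trans (cong x ssj≡m) x-m≡b)) deg-z) b-not-deg2

    near-along-endpath : ∀ j {v} → j < m → v ∈ˡ endpath j → dist G l v < m
    near-along-endpath j j<m v∈ with ∈-endpath⁻ j v∈
    ... | t , t≤j , refl = ≤-<-trans (dist-x≤ t) (≤-<-trans t≤j j<m)

    near-along-path : ∀ {u} z zs → Deg2 G u → lastOr G z zs ≡ l → Unique (z ∷ zs) → Linked (Adj G) (z ∷ zs) →
                      Internal G (Deg2 G) (z ∷ zs) → u ∈ˡ z ∷ zs → dist G l u < m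
    near-along-path z []       deg-u z≡l _ _ _ (here refl) = contradiction (trans (sym leaf) (subst (Deg2 G) z≡l deg-u)) λ ()
    near-along-path z (y ∷ ys) deg-u last uniq linked int (here refl)
      with into-leaf-along-endpath z z (y ∷ ys) linked uniq last (deg-u , int)
    ... | j , j<m , path≡ = near-along-endpath j j<m (subst (z ∈ˡ_) path≡ (here refl))
    near-along-path {u} z (y ∷ ys) deg-u last (_ ∷ uniq) (_ ∷ linked) int (there u∈)
      with into-leaf-along-endpath z y ys linked uniq last int
    ... | j , j<m , path≡ = near-along-endpath j j<m (subst (u ∈ˡ_) path≡ u∈)

    far-vertex : ∃ λ y → suc m ≤ dist G l y
    far-vertex with neighbour-other-than (≤-trans (n≤1+n 2) b-branch) (x (ℕ.pred m))
    ... | y , by , y≢xpm = y , beyond (walk-from-leaf _ (reach-by-dist connected l y))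
      where
      x-adj-b : ∀ {j} → y ≡ x j → Adj G (x j) (x m)
      x-adj-b y≡xj = subst₂ (Adj G) y≡xj (sym x-m≡b) (Adj-sym by)
      beyond : (∃ λ j → j < m × y ≡ x j) ⊎ (m ≤ dist G l y × Reach (dist G l y ∸ m) b y) → suc m ≤ dist G l y
      beyond (inj₁ (zero , _ , y≡x₀)) =
        contradiction (subst (λ t → y ≡ x (ℕ.pred t)) (sym (x-injective ≤-refl 1≤m (l-neighbour (x-adj-b {0} y≡x₀)))) y≡x₀) y≢xpm
      beyond (inj₁ (suc j , sj<m , y≡xsj)) with x-neighbours sj<m (x-adj-b {suc j} y≡xsj)
      ... | inj₁ xm≡xj   = contradiction (x-injective ≤-refl (≤-trans (n≤1+n j) (<⇒≤ sj<m)) xm≡xj) (<⇒≢ (<-trans (n<1+n j) sj<m) ∘ sym)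
      ... | inj₂ xm≡xssj = contradiction (subst (λ t → y ≡ x (ℕ.pred t)) (sym (x-injective ≤-refl sj<m xm≡xssj)) y≡xsj) y≢xpm
      beyond (inj₂ (m≤d , r)) = begin
        suc m                    ≡⟨ +-comm 1 m ⟩
        m + 1                    ≤⟨ +-monoʳ-≤ m (1≤reach _ r (Adj-irrefl by)) ⟩
        m + (dist G l y ∸ m)     ≡⟨ m+[n∸m]≡n m≤d ⟩
        dist G l y               ∎
        where open ≤-Reasoning

  Wext⇒near-leaf : ∀ {u} → InWext G u → ∃ λ l′ → ∃ λ (leaf′ : IsLeaf G l′) → dist G l′ u < branchDist l′
  Wext⇒near-leaf (deg-u , z ∷ zs , (_ , l′ , (_ , last , uniq , linked) , leaf′ , int) , u∈) =
    l′ , leaf′ , Endpath.near-along-path l′ leaf′ z zs deg-u last uniq linked int u∈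

-- The broadcast

module BoundaryIndependentBroadcast {n : ℕ} (G : Graph n) (connected : Connected G)
  (b₀ : Fin n) (b₀-branch : IsBranch G b₀) (S : Subset n) (S⊆Int : ∀ v → v ∈ S → InInt G v)
  (S-independent : ∀ u v → u ∈ S → v ∈ S → ¬ Adj G u v) where

  open GraphProperties G
  open Endpaths G connected b₀ b₀-branch

  S-separated : ∀ {k u v} → u ≢ v → Reach k u v → 𝟙 (u ∈? S) + 𝟙 (v ∈? S) ≤ k
  S-separated {k} {u} {v} u≢v r = cases (u ∈? S) (v ∈? S)
    where
    cases : (du : Dec (u ∈ S)) (dv : Dec (v ∈ S)) → 𝟙 du + 𝟙 dv ≤ k
    cases (yes u∈S) (yes v∈S) = 2≤reach k r u≢v (S-independent u v u∈S v∈S)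
    cases (yes _)   (no _)    = 1≤reach k r u≢v
    cases (no _)    (yes _)   = 1≤reach k r u≢v
    cases (no _)    (no _)    = z≤n

  endpath-avoids-S : ∀ l (leaf : IsLeaf G l) {j} → j < Endpath.m l leaf → Endpath.x l leaf j ∉ S
  endpath-avoids-S l leaf {j} j<m x∈S with Int⇒branch⊎Wint (S⊆Int _ x∈S)
  ... | inj₁ br                 = Endpath.x-not-branch l leaf j<m br
  ... | inj₂ (deg≡2 , not-Wext) with j
  ...   | zero    = contradiction (trans (sym leaf) deg≡2) λ ()
  ...   | suc _   = not-Wext (Endpath.x∈Wext l leaf j<m)

  shared-end∉S : ∀ l₁ l₂ → IsLeaf G l₁ → IsLeaf G l₂ → l₁ ≢ l₂ → nearestBranch l₁ ≡ nearestBranch l₂ →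
                 nearestBranch l₁ ∉ S
  shared-end∉S l₁ l₂ leaf₁ leaf₂ l₁≢l₂ same b∈S = from-Int (S⊆Int _ b∈S)
    where
    from-Int : InInt G (nearestBranch l₁) → ⊥
    from-Int (inj₁ (_ , no-leaves))          = no-leaves l₁ (Endpath.l∈L[b] l₁ leaf₁)
    from-Int (inj₂ (inj₁ (_ , l , _ , only))) =
      l₁≢l₂ (trans (only l₁ (Endpath.l∈L[b] l₁ leaf₁))
                   (sym (only l₂ (subst (λ b → InLeafSet G b l₂) (sym same) (Endpath.l∈L[b] l₂ leaf₂)))))
    from-Int (inj₂ (inj₂ (deg≡2 , _)))        = contradiction (subst (3 ≤_) deg≡2 (nearestBranch-isBranch l₁)) λ { (s≤s (s≤s ())) }

  EndsEndpath : Fin n → Set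
  EndsEndpath v = ∃ λ l → IsLeaf G l × nearestBranch l ≡ v

  endsEndpath? : ∀ v → Dec (EndsEndpath v)
  endsEndpath? v = Fin.any? (λ l → (deg G l ℕ.≟ 1) ×-dec (nearestBranch l ≟ v))

  broadcastAt : ∀ v → Dec (IsLeaf G v) → ℕ
  broadcastAt v (yes _) = branchDist v + 𝟙 (nearestBranch v ∈? S)
  broadcastAt v (no _)  = 𝟙 (v ∈? S ×-dec ¬? (endsEndpath? v))

  broadcast : Fin n → ℕ
  broadcast v = broadcastAt v (deg G v ℕ.≟ 1)

  broadcast-leaf : ∀ {v} → IsLeaf G v → broadcast v ≡ branchDist v + 𝟙 (nearestBranch v ∈? S)
  broadcast-leaf {v} leaf = at (deg G v ℕ.≟ 1)
    where
    at : (d : Dec (IsLeaf G v)) → broadcastAt v d ≡ branchDist v + 𝟙 (nearestBranch v ∈? S)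
    at (yes _)    = refl
    at (no ¬leaf) = contradiction leaf ¬leaf

  broadcast-inner : ∀ {v} → ¬ IsLeaf G v → broadcast v ≡ 𝟙 (v ∈? S ×-dec ¬? (endsEndpath? v))
  broadcast-inner {v} ¬leaf = at (deg G v ℕ.≟ 1)
    where
    at : (d : Dec (IsLeaf G v)) → broadcastAt v d ≡ 𝟙 (v ∈? S ×-dec ¬? (endsEndpath? v))
    at (yes leaf) = contradiction leaf ¬leaf
    at (no _)     = refl

  broadcast-inner≤S : ∀ {v} → ¬ IsLeaf G v → broadcast v ≤ 𝟙 (v ∈? S)
  broadcast-inner≤S {v} ¬leaf = subst (_≤ _) (sym (broadcast-inner ¬leaf)) (both (v ∈? S) (endsEndpath? v))
    where
    both : (d : Dec (v ∈ S)) (e : Dec (EndsEndpath v)) → 𝟙 (d ×-dec ¬? e) ≤ 𝟙 d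
    both (yes v∈S) e = 𝟙≤1 (yes v∈S ×-dec ¬? e)
    both (no _)    e = z≤n

  broadcast-inner-active : ∀ {v} → ¬ IsLeaf G v → 0 < broadcast v → v ∈ S × ¬ EndsEndpath v
  broadcast-inner-active {v} ¬leaf 0<f =
    𝟙≢0⇒ (v ∈? S ×-dec ¬? (endsEndpath? v)) λ 𝟙≡0 → <-irrefl (sym (trans (broadcast-inner ¬leaf) 𝟙≡0)) 0<f

  bonus : Fin n → ℕ
  bonus l = 𝟙 (nearestBranch l ∈? S)

  leaf-to-leaf : ∀ {k l₁ l₂} → IsLeaf G l₁ → IsLeaf G l₂ → l₁ ≢ l₂ → Reach k l₁ l₂ →
                 branchDist l₁ ≤ k × branchDist l₂ ≤ k ∸ branchDist l₁ ×
                 Reach (k ∸ branchDist l₁ ∸ branchDist l₂) (nearestBranch l₂) (nearestBranch l₁)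
  leaf-to-leaf {k} {l₁} {l₂} leaf₁ leaf₂ l₁≢l₂ r with Endpath.walk-from-leaf l₁ leaf₁ k r
  ... | inj₁ (zero , _ , l₂≡l₁)     = contradiction (sym l₂≡l₁) l₁≢l₂
  ... | inj₁ (suc j , sj<m , l₂≡x)  =
    contradiction (trans (sym leaf₂) (trans (cong (deg G) l₂≡x) (Endpath.deg-x≡2 l₁ leaf₁ sj<m))) λ ()
  ... | inj₂ (m₁≤k , r₁) with Endpath.walk-from-leaf l₂ leaf₂ _ (reach-sym _ r₁)
  ...   | inj₁ (j , j<m , b₁≡x) = contradiction (subst (IsBranch G) b₁≡x (nearestBranch-isBranch l₁)) (Endpath.x-not-branch l₂ leaf₂ j<m)
  ...   | inj₂ (m₂≤ , r₂)       = m₁≤k , m₂≤ , r₂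

  bonuses≤ : ∀ {t l₁ l₂} → IsLeaf G l₁ → IsLeaf G l₂ → l₁ ≢ l₂ → Reach t (nearestBranch l₂) (nearestBranch l₁) →
             bonus l₁ + bonus l₂ ≤ t
  bonuses≤ {t} {l₁} {l₂} leaf₁ leaf₂ l₁≢l₂ r with nearestBranch l₁ ≟ nearestBranch l₂
  ... | yes same = ≤-trans (≤-reflexive (cong₂ _+_ (𝟙-no (_ ∈? S) (shared-end∉S l₁ l₂ leaf₁ leaf₂ l₁≢l₂ same))
                                                   (𝟙-no (_ ∈? S) (shared-end∉S l₂ l₁ leaf₂ leaf₁ (l₁≢l₂ ∘ sym) (sym same)))))
                           z≤n
  ... | no differ = subst (_≤ t) (+-comm (bonus l₂) (bonus l₁)) (S-separated (differ ∘ sym) r)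

  leaves-separated : ∀ {k l₁ l₂} → IsLeaf G l₁ → IsLeaf G l₂ → l₁ ≢ l₂ → Reach k l₁ l₂ →
                     broadcast l₁ + broadcast l₂ ≤ k
  leaves-separated {k} {l₁} {l₂} leaf₁ leaf₂ l₁≢l₂ r with leaf-to-leaf leaf₁ leaf₂ l₁≢l₂ r
  ... | m₁≤k , m₂≤ , r₂ = begin
    broadcast l₁ + broadcast l₂               ≡⟨ cong₂ _+_ (broadcast-leaf leaf₁) (broadcast-leaf leaf₂) ⟩
    (m₁ + bonus l₁) + (m₂ + bonus l₂)         ≡⟨ +-assoc m₁ (bonus l₁) _ ⟩
    m₁ + (bonus l₁ + (m₂ + bonus l₂))         ≡⟨ cong (m₁ +_) (x∙yz≈y∙xz (bonus l₁) m₂ (bonus l₂)) ⟩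
    m₁ + (m₂ + (bonus l₁ + bonus l₂))         ≤⟨ +-≤-via-∸ m₁≤k (+-≤-via-∸ m₂≤ (bonuses≤ leaf₁ leaf₂ l₁≢l₂ r₂)) ⟩
    k                                         ∎
    where
    open ≤-Reasoning
    m₁ m₂ : ℕ
    m₁ = branchDist l₁
    m₂ = branchDist l₂

  leaf-inner-separated : ∀ {k l s} → IsLeaf G l → s ∈ S → ¬ EndsEndpath s → Reach k l s →
                         branchDist l + bonus l + 1 ≤ k
  leaf-inner-separated {k} {l} {s} leaf s∈S not-end r with Endpath.walk-from-leaf l leaf k r
  ... | inj₁ (j , j<m , s≡x) = contradiction (subst (_∈ S) s≡x s∈S) (endpath-avoids-S l leaf j<m)
  ... | inj₂ (m≤k , r′)      = begin
    branchDist l + bonus l + 1   ≡⟨ +-assoc (branchDist l) (bonus l) 1 ⟩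
    branchDist l + (bonus l + 1) ≤⟨ +-≤-via-∸ m≤k (subst (λ e → bonus l + e ≤ _) (𝟙-yes (s ∈? S) s∈S)
                                                         (S-separated (λ b≡s → not-end (l , leaf , b≡s)) r′)) ⟩
    k                            ∎
    where open ≤-Reasoning

  broadcast-active-inner≡1 : ∀ {v} → ¬ IsLeaf G v → 0 < broadcast v → broadcast v ≡ 1
  broadcast-active-inner≡1 {v} ¬leaf 0<f = ≤-antisym (≤-trans (broadcast-inner≤S ¬leaf) (𝟙≤1 (v ∈? S))) 0<f

  broadcasters-separated : ∀ {k v₁ v₂} → v₁ ≢ v₂ → 0 < broadcast v₁ → 0 < broadcast v₂ → Reach k v₁ v₂ →
                           broadcast v₁ + broadcast v₂ ≤ k
  broadcasters-separated {k} {v₁} {v₂} v₁≢v₂ f₁ f₂ r = cases (deg G v₁ ℕ.≟ 1) (deg G v₂ ℕ.≟ 1)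
    where
    cases : Dec (IsLeaf G v₁) → Dec (IsLeaf G v₂) → broadcast v₁ + broadcast v₂ ≤ k
    cases (yes leaf₁) (yes leaf₂) = leaves-separated leaf₁ leaf₂ v₁≢v₂ r
    cases (yes leaf₁) (no ¬leaf₂) with broadcast-inner-active ¬leaf₂ f₂
    ... | v₂∈S , not-end =
      subst (_≤ k) (sym (cong₂ _+_ (broadcast-leaf leaf₁) (broadcast-active-inner≡1 ¬leaf₂ f₂)))
            (leaf-inner-separated leaf₁ v₂∈S not-end r)
    cases (no ¬leaf₁) (yes leaf₂) with broadcast-inner-active ¬leaf₁ f₁
    ... | v₁∈S , not-end =
      subst (_≤ k) (trans (+-comm _ 1) (sym (cong₂ _+_ (broadcast-active-inner≡1 ¬leaf₁ f₁) (broadcast-leaf leaf₂))))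
            (leaf-inner-separated leaf₂ v₁∈S not-end (reach-sym k r))
    cases (no ¬leaf₁) (no ¬leaf₂) =
      ≤-trans (+-mono-≤ (broadcast-inner≤S ¬leaf₁) (broadcast-inner≤S ¬leaf₂)) (S-separated v₁≢v₂ r)

  broadcast-bnIndependent : BnIndependent G broadcast
  broadcast-bnIndependent w v₁ v₂ v₁≢v₂ (f₁ , d₁) (f₂ , d₂) =
    ≤-+-tight d₁ d₂ (broadcasters-separated v₁≢v₂ f₁ f₂
      (reach-trans (dist G w v₁) (reach-sym _ (reach-by-dist connected w v₁)) (reach-by-dist connected w v₂)))

  broadcast-isBroadcast : IsBroadcast G broadcast
  broadcast-isBroadcast v = at (deg G v ℕ.≟ 1)
    where
    with-bonus : IsLeaf G v → (d : Dec (nearestBranch v ∈ S)) → branchDist v + 𝟙 d ≤ ecc G v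
    with-bonus leaf (no _)  = ≤-trans (≤-reflexive (+-identityʳ _)) (dist≤ecc v (nearestBranch v))
    with-bonus leaf (yes _) with Endpath.far-vertex v leaf
    ... | y , sm≤d = ≤-trans (≤-trans (≤-reflexive (+-comm _ 1)) sm≤d) (dist≤ecc v y)
    active : (d : Dec (v ∈ S × ¬ EndsEndpath v)) → 𝟙 d ≤ ecc G v
    active (no _)          = z≤n
    active (yes (v∈S , _)) with neighbour (Int⇒1≤deg (S⊆Int v v∈S))
    ... | y , vy = ≤-trans (1≤dist G (Adj-irrefl vy)) (dist≤ecc v y)
    at : (d : Dec (IsLeaf G v)) → broadcastAt v d ≤ ecc G v
    at (yes leaf) = with-bonus leaf (nearestBranch v ∈? S)
    at (no _)     = active (v ∈? S ×-dec ¬? (endsEndpath? v))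

-- Its weight

module WeightBound {n : ℕ} (G : Graph n) (connected : Connected G)
  (b₀ : Fin n) (b₀-branch : IsBranch G b₀) (S : Subset n) (S⊆Int : ∀ v → v ∈ S → InInt G v)
  (S-independent : ∀ u v → u ∈ S → v ∈ S → ¬ Adj G u v)
  (B Wi : Subset n) (B-spec : ∀ v → (v ∈ B) ⇔ IsBranch G v) (Wi-spec : ∀ v → (v ∈ Wi) ⇔ InWint G v) where

  open GraphProperties G
  open Endpaths G connected b₀ b₀-branch
  open BoundaryIndependentBroadcast G connected b₀ b₀-branch S S⊆Int S-independent

  Charged : Fin n → Set
  Charged v = v ∈ S ⊎ (v ∉ B × v ∉ Wi)

  charged? : ∀ v → Dec (Charged v)
  charged? v = (v ∈? S) ⊎-dec (¬? (v ∈? B) ×-dec ¬? (v ∈? Wi))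

  charge : Fin n → ℕ
  charge v = 𝟙 (charged? v)

  1+S≤charge+B+Wi : ∀ v → 1 + 𝟙 (v ∈? S) ≤ charge v + 𝟙 (v ∈? B) + 𝟙 (v ∈? Wi)
  1+S≤charge+B+Wi v = cases (v ∈? S) (v ∈? B) (v ∈? Wi)
    where
    cases : (dS : Dec (v ∈ S)) (dB : Dec (v ∈ B)) (dW : Dec (v ∈ Wi)) →
            1 + 𝟙 dS ≤ 𝟙 (dS ⊎-dec (¬? dB ×-dec ¬? dW)) + 𝟙 dB + 𝟙 dW
    cases (yes _)   (yes _)  _        = s≤s (s≤s z≤n)
    cases (yes _)   (no _)   (yes _)  = s≤s (s≤s z≤n)
    cases (yes v∈S) (no v∉B) (no v∉W) with Int⇒branch⊎Wint (S⊆Int v v∈S)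
    ... | inj₁ br   = contradiction (from (B-spec v) br) v∉B
    ... | inj₂ wint = contradiction (from (Wi-spec v) wint) v∉W
    cases (no _)    (yes _)  _        = s≤s z≤n
    cases (no _)    (no _)   (yes _)  = s≤s z≤n
    cases (no _)    (no _)   (no _)   = s≤s z≤n

  Covered : Fin n → Fin n → Set
  Covered l v = IsLeaf G l × (dist G l v < branchDist l ⊎ (nearestBranch l ≡ v × v ∈ S))

  covered? : ∀ l v → Dec (Covered l v)
  covered? l v = (deg G l ℕ.≟ 1) ×-dec ((dist G l v ℕ.<? branchDist l) ⊎-dec ((nearestBranch l ≟ v) ×-dec (v ∈? S)))

  ownerAmong : ∀ v → Dec (∃ λ l → Covered l v) → Fin n
  ownerAmong v (yes (l , _)) = l
  ownerAmong v (no _)        = v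

  owner : Fin n → Fin n
  owner v = ownerAmong v (Fin.any? (λ l → covered? l v))

  owner-spec : ∀ v → Covered (owner v) v ⊎ (¬ ∃ (λ l → Covered l v) × owner v ≡ v)
  owner-spec v = spec (Fin.any? (λ l → covered? l v))
    where
    spec : (d : Dec (∃ λ l → Covered l v)) → Covered (ownerAmong v d) v ⊎ (¬ ∃ (λ l → Covered l v) × ownerAmong v d ≡ v)
    spec (yes (_ , cov)) = inj₁ cov
    spec (no uncovered)  = inj₂ (uncovered , refl)

  leaf-covers-itself : ∀ {l} → IsLeaf G l → Covered l l
  leaf-covers-itself {l} leaf = leaf , inj₁ (subst (_< branchDist l) (sym (dist-refl l)) (Endpath.1≤m l leaf))

  uncovered-charge≤broadcast : ∀ {u} → ¬ IsLeaf G u → ¬ ∃ (λ l → Covered l u) → charge u ≤ broadcast u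
  uncovered-charge≤broadcast {u} ¬leaf uncovered = by-cases (charged? u)
    where
    by-cases : (d : Dec (Charged u)) → 𝟙 d ≤ broadcast u
    by-cases (no _)                    = z≤n
    by-cases (yes (inj₁ u∈S))          = ≤-reflexive (sym (trans (broadcast-inner ¬leaf)
      (𝟙-yes (u ∈? S ×-dec ¬? (endsEndpath? u)) (u∈S , λ { (l , leaf , b≡u) → uncovered (l , leaf , inj₂ (b≡u , u∈S)) }))))
    by-cases (yes (inj₂ (u∉B , u∉W))) = contradiction (from (Wi-spec u) (deg≡2 , not-Wext)) u∉W
      where
      ¬branch : ¬ IsBranch G u
      ¬branch = u∉B ∘ from (B-spec u)
      deg≡2 : Deg2 G u
      deg≡2 with reach-neighbour _ (reach-by-dist connected u b₀) (λ u≡b₀ → ¬branch (subst (IsBranch G) (sym u≡b₀) b₀-branch))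
      ... | _ , uy = ≤-antisym (≤-pred (≰⇒> ¬branch)) (≤∧≢⇒< (1≤deg uy) (¬leaf ∘ sym))
      not-Wext : ¬ InWext G u
      not-Wext wext with Wext⇒near-leaf wext
      ... | l , leaf , near = uncovered (l , leaf , inj₁ near)

  leaf-fibre : ∀ {u} → IsLeaf G u → ∑[ v < n ] (𝟙 (owner v ≟ u) * charge v) ≤ broadcast u
  leaf-fibre {u} leaf = begin
    ∑[ v < n ] (𝟙 (owner v ≟ u) * charge v)       ≤⟨ ∑-mono-≤ (λ v → 𝟙*-≤ (owner v ≟ u) (charge v) (owned v)) ⟩
    ∑[ v < n ] (𝟙 (near? v) + 𝟙 (end? v))         ≡⟨ ∑-distrib-+ (λ v → 𝟙 (near? v)) (λ v → 𝟙 (end? v)) ⟩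
    ∑[ v < n ] 𝟙 (near? v) + ∑[ v < n ] 𝟙 (end? v) ≤⟨ +-mono-≤ near-count (≤-reflexive end-count) ⟩
    branchDist u + bonus u                        ≡⟨ broadcast-leaf leaf ⟨
    broadcast u                                   ∎
    where
    open ≤-Reasoning
    open Endpath u leaf using (x; near⇒on-endpath)
    near? : ∀ v → Dec (dist G u v < branchDist u)
    near? v = dist G u v ℕ.<? branchDist u
    end? : ∀ v → Dec (nearestBranch u ≡ v × v ∈ S)
    end? v = (nearestBranch u ≟ v) ×-dec (v ∈? S)
    covered-by-u : ∀ {v} → owner v ≡ u → Covered u v
    covered-by-u {v} owner≡u =
      [ subst (λ l → Covered l v) owner≡u
      , (λ (uncovered , owner≡v) →
           contradiction (u , subst (Covered u) (trans (sym owner≡u) owner≡v) (leaf-covers-itself leaf)) uncovered)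
      ]′ (owner-spec v)
    counted : ∀ {v} → dist G u v < branchDist u ⊎ (nearestBranch u ≡ v × v ∈ S) → 1 ≤ 𝟙 (near? v) + 𝟙 (end? v)
    counted {v} = [ (λ near → ≤-trans (≤-reflexive (sym (𝟙-yes (near? v) near))) (m≤m+n _ _))
                  , (λ end → ≤-trans (≤-reflexive (sym (𝟙-yes (end? v) end))) (m≤n+m _ _)) ]′
    owned : ∀ v → owner v ≡ u → charge v ≤ 𝟙 (near? v) + 𝟙 (end? v)
    owned v owner≡u = ≤-trans (𝟙≤1 (charged? v)) (counted (proj₂ (covered-by-u owner≡u)))
    near-count : ∑[ v < n ] 𝟙 (near? v) ≤ branchDist u
    near-count = ∑-𝟙-≤-injection near? (dist G u) (λ _ near → near)
      λ i j near-i near-j same → trans (near⇒on-endpath near-i) (trans (cong x same) (sym (near⇒on-endpath near-j)))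
    end-count : ∑[ v < n ] 𝟙 (end? v) ≡ bonus u
    end-count = trans (∑-supported-at (nearestBranch u) λ v v≢b → 𝟙-no (end? v) λ (b≡v , _) → v≢b (sym b≡v))
                      (𝟙-cong proj₂ (refl ,_) (end? (nearestBranch u)) (nearestBranch u ∈? S))

  inner-fibre : ∀ {u} → ¬ IsLeaf G u → ∑[ v < n ] (𝟙 (owner v ≟ u) * charge v) ≤ broadcast u
  inner-fibre {u} ¬leaf = begin
    ∑[ v < n ] (𝟙 (owner v ≟ u) * charge v) ≡⟨ ∑-supported-at u off ⟩
    𝟙 (owner u ≟ u) * charge u              ≤⟨ 𝟙*-≤ (owner u ≟ u) (charge u) at-u ⟩
    broadcast u                             ∎
    where
    open ≤-Reasoning
    owned⇒≡u : ∀ {v} → owner v ≡ u → v ≡ u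
    owned⇒≡u {v} owner≡u =
      [ (λ cov → contradiction (subst (IsLeaf G) owner≡u (proj₁ cov)) ¬leaf)
      , (λ (_ , owner≡v) → trans (sym owner≡v) owner≡u) ]′ (owner-spec v)
    off : ∀ v → v ≢ u → 𝟙 (owner v ≟ u) * charge v ≡ 0
    off v v≢u = cong (_* charge v) (𝟙-no (owner v ≟ u) (v≢u ∘ owned⇒≡u))
    at-u : owner u ≡ u → charge u ≤ broadcast u
    at-u owner≡u =
      [ (λ cov → contradiction (subst (IsLeaf G) owner≡u (proj₁ cov)) ¬leaf)
      , (λ (uncovered , _) → uncovered-charge≤broadcast ¬leaf uncovered) ]′ (owner-spec u)

  fibre≤broadcast : ∀ u → ∑[ v < n ] (𝟙 (owner v ≟ u) * charge v) ≤ broadcast u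
  fibre≤broadcast u = by-cases (deg G u ℕ.≟ 1)
    where
    by-cases : Dec (IsLeaf G u) → ∑[ v < n ] (𝟙 (owner v ≟ u) * charge v) ≤ broadcast u
    by-cases (yes leaf) = leaf-fibre leaf
    by-cases (no ¬leaf) = inner-fibre ¬leaf

  weight-bound : n + ∣ S ∣ ≤ weight G broadcast + ∣ B ∣ + ∣ Wi ∣
  weight-bound = begin
    n + ∣ S ∣                                                   ≡⟨ cong₂ _+_ (sym (∑-const-1 n)) (∣p∣≡∑𝟙 S) ⟩
    ∑[ v < n ] 1 + ∑[ v < n ] 𝟙 (v ∈? S)                        ≡⟨ ∑-distrib-+ (λ _ → 1) (λ v → 𝟙 (v ∈? S)) ⟨
    ∑[ v < n ] (1 + 𝟙 (v ∈? S))                                 ≤⟨ ∑-mono-≤ 1+S≤charge+B+Wi ⟩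
    ∑[ v < n ] (charge v + 𝟙 (v ∈? B) + 𝟙 (v ∈? Wi))            ≡⟨ ∑-distrib-+ (λ v → charge v + 𝟙 (v ∈? B)) (λ v → 𝟙 (v ∈? Wi)) ⟩
    ∑[ v < n ] (charge v + 𝟙 (v ∈? B)) + ∑[ v < n ] 𝟙 (v ∈? Wi) ≡⟨ cong (_+ _) (∑-distrib-+ charge (λ v → 𝟙 (v ∈? B))) ⟩
    ∑[ v < n ] charge v + ∑[ v < n ] 𝟙 (v ∈? B) + ∑[ v < n ] 𝟙 (v ∈? Wi)
      ≤⟨ +-monoˡ-≤ _ (+-monoˡ-≤ _ (∑-by-fibres owner charge broadcast fibre≤broadcast)) ⟩
    ∑[ v < n ] broadcast v + ∑[ v < n ] 𝟙 (v ∈? B) + ∑[ v < n ] 𝟙 (v ∈? Wi)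
      ≡⟨ cong₂ _+_ (cong₂ _+_ (sum-map-allFin broadcast) (∣p∣≡∑𝟙 B)) (∣p∣≡∑𝟙 Wi) ⟨
    weight G broadcast + ∣ B ∣ + ∣ Wi ∣                           ∎
    where open ≤-Reasoning

theorem1 : ∀ {n : ℕ} (T : Graph n) → IsTree T →
    (B Wi : Subset n) →
    (∀ v → (v ∈ B) ⇔ IsBranch T v) →
    (∀ v → (v ∈ Wi) ⇔ InWint T v) →
    1 ≤ ∣ B ∣ →
    (S : Subset n) →
    (∀ v → v ∈ S → InInt T v) →
    (∀ u v → u ∈ S → v ∈ S → ¬ Adj T u v) →
    ∃[ f ] (IsBroadcast T f × BnIndependent T f ×
      n + ∣ S ∣ ≤ weight T f + ∣ B ∣ + ∣ Wi ∣)
theorem1 T (connected , _) B Wi B-spec Wi-spec 1≤∣B∣ S S⊆Int S-independent =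
  broadcast , broadcast-isBroadcast , broadcast-bnIndependent , weight-bound
  where
  b₀ : Fin _
  b₀ = proj₁ (1≤∣p∣⇒nonempty B 1≤∣B∣)
  b₀-branch : IsBranch T b₀
  b₀-branch = to (B-spec b₀) (proj₂ (1≤∣p∣⇒nonempty B 1≤∣B∣))
  open BoundaryIndependentBroadcast T connected b₀ b₀-branch S S⊆Int S-independent
    using (broadcast; broadcast-isBroadcast; broadcast-bnIndependent)
  open WeightBound T connected b₀ b₀-branch S S⊆Int S-independent B Wi B-spec Wi-spec using (weight-bound)
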